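{- Let $t$ be a $\rhd\mathsf{shuf}$-normalizable term and $t_0$ its $\rhd\mathsf{shuf}$-normal form. For every reduction sequence $d$ from $t$ to $t_0$ by $\rhd\mathsf{shuf}$-steps, every derivation $\pi$ with subject $t$ such that $|\pi| = \min\{|\pi'| \mid \pi' \text{ a derivation with subject } t\}$, and every derivation $\pi_0$ with subject $t_0$ such that $|\pi_0| = \min\{|\pi_0'| \mid \pi_0' \text{ a derivation with subject } t_0\}$, one has $|d|_{\beta_v} = |\pi| - |t_0|_0 = |\pi| - |\pi_0|$. If moreover $t_0$ is a value, then $|d|_{\beta_v} = |\pi|$.
   Context: Terms: $t ::= x \mid \lambda x.t \mid tu$ (up to $\alpha$); values $v ::= x \mid \lambda x.t$; $\mathrm{Fv}(t)$ free variables; $t\{v/x\}$ substitution. Root steps: ($\beta_v$) $(\lambda x.t)v \mapsto t\{v/x\}$, $v$ a value; ($\sigma_1$) $(\lambda x.t)us \mapsto (\lambda x.ts)u$ if $x\notin\mathrm{Fv}(s)$; ($\sigma_3$) $v((\lambda x.s)u)\mapsto(\lambda x.vs)u$ if $v$ a value, $x\notin\mathrm{Fv}(v)$. Balanced contexts $B ::= [\cdot] \mid (\lambda x.B)t \mid Bt \mid tB$; $\rhd r$-reduction is the closure of root step $r$ under balanced contexts; $\rhd\mathsf{shuf}$ is the union of $\rhd\beta_v,\rhd\sigma_1,\rhd\sigma_3$. $|d|_{\beta_v}$ is the number of $\rhd\beta_v$-steps in the sequence $d$. Normal-form grammar: $a ::= xv \mid xa \mid an$ and $n ::= v \mid a \mid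 (\lambda x.n)a$. For $t$ generated by $n$: $|v|_0=0$, $|xv|_0 = 1$, $|xa|_0 = |a|_0+1$, $|an|_0 = |a|_0+|n|_0+1$, $|(\lambda x.n)a|_0 = |n|_0+|a|_0+1$ ($\rhd\mathsf{shuf}$-normal terms are exactly those generated by $n$). Types: positive types are finite multisets $[(P_1,Q_1),\dots,(P_n,Q_n)]$ of pairs of positive types ($\mathbf{0}$ empty, $\uplus$ union). Environments map variables to positive types (finitely many non-$\mathbf{0}$), combined pointwise by $\uplus$. Rules: (ax) $x\colon P\vdash x\colon P$; ($\lambda$) from $\Gamma_i,x\colon P_i\vdash t\colon Q_i$ ($1\le i\le n$, $n\ge0$) infer $\biguplus_i\Gamma_i\vdash\lambda x.t\colon[(P_1,Q_1),\dots,(P_n,Q_n)]$; ($@$) from $\Gamma\vdash t\colon[(P,Q)]$ and $\Delta\vdash u\colon P$ infer $\Gamma\uplus\Delta\vdash tu\colon Q$. A derivation has subject $t$ if its conclusion is $\Gamma\vdash t\colon Q$ for some $\Gamma,Q$. The size $|\pi|$ of a derivation is the number of $@$ rules in it. -}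

module Defs where

open import Data.Nat using (ℕ; zero; suc; _+_; _≡ᵇ_)
open import Data.Bool using (if_then_else_)
open import Data.List using (List; []; _∷_; _++_)
open import Data.Product using (_×_; _,_; Σ; ∃)

-- Terms (de Bruijn indices, so terms are identified up to α)

data Term : Set where
  var : ℕ → Term
  lam : Term → Term
  app : Term → Term → Term

data Value : Term → Set where
  var : ∀ x → Value (var x)
  lam : ∀ t → Value (lam t)

ext : (ℕ → ℕ) → ℕ → ℕ
ext ρ zero    = zero
ext ρ (suc n) = suc (ρ n)

rename : (ℕ → ℕ) → Term → Term
rename ρ (var x)   = var (ρ x)
rename ρ (lam t)   = lam (rename (ext ρ) t)
rename ρ (app t u) = app (rename ρ t) (rename ρ u)

exts : (ℕ → Term) → ℕ → Term
exts σ zero    = var zero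
exts σ (suc n) = rename suc (σ n)

subst : (ℕ → Term) → Term → Term
subst σ (var x)   = σ x
subst σ (lam t)   = lam (subst (exts σ) t)
subst σ (app t u) = app (subst σ t) (subst σ u)

-- t{v/x} where x is the bound variable 0 of the body t
_[_] : Term → Term → Term
t [ v ] = subst σ t
  where
  σ : ℕ → Term
  σ zero    = v
  σ (suc n) = var n

-- weakening: a term placed under one more binder (x ∉ Fv of it)
↑ : Term → Term
↑ = rename suc

data Rule : Set where
  βv σ₁ σ₃ : Rule

data Root : Rule → Term → Term → Set where
  βv-root : ∀ {t v} → Value v → Root βv (app (lam t) v) (t [ v ])
  -- (λx.t)us ↦ (λx.ts)u , x ∉ Fv(s)
  σ₁-root : ∀ {t u s} → Root σ₁ (app (app (lam t) u) s) (app (lam (app t (↑ s))) u)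
  -- v((λx.s)u) ↦ (λx.vs)u , v a value, x ∉ Fv(v)
  σ₃-root : ∀ {v s u} → Value v →
            Root σ₃ (app v (app (lam s) u)) (app (lam (app (↑ v) s)) u)

-- closure under balanced contexts B ::= [·] | (λx.B)t | Bt | tB
data Step (r : Rule) : Term → Term → Set where
  root  : ∀ {t t'} → Root r t t' → Step r t t'
  lamB  : ∀ {t t' u} → Step r t t' → Step r (app (lam t) u) (app (lam t') u)
  appL  : ∀ {t t' u} → Step r t t' → Step r (app t u) (app t' u)
  appR  : ∀ {t u u'} → Step r u u' → Step r (app t u) (app t u')

ShufStep : Term → Term → Set
ShufStep t t' = Σ Rule λ r → Step r t t'

ShufNormal : Term → Set
ShufNormal t = ∀ t' → ShufStep t t' → Data.Empty.⊥
  where import Data.Empty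

data Seq : Term → Term → Set where
  done : ∀ {t} → Seq t t
  _∷_  : ∀ {t t' t''} {r : Rule} → Step r t t' → Seq t' t'' → Seq t t''

#βv : ∀ {t t'} → Seq t t' → ℕ
#βv done             = 0
#βv (_∷_ {r = βv} _ d) = suc (#βv d)
#βv (_∷_ {r = σ₁} _ d) = #βv d
#βv (_∷_ {r = σ₃} _ d) = #βv d

-- Normal-form grammar  a ::= xv | xa | an ,  n ::= v | a | (λx.n)a
-- with the size |·|₀ computed on the generating derivation.

mutual
  data GenA : Term → Set where
    xv : ∀ x {v} → Value v → GenA (app (var x) v)
    xa : ∀ x {a} → GenA a → GenA (app (var x) a)
    an : ∀ {a n} → GenA a → GenN n → GenA (app a n)

  data GenN : Term → Set where
    v   : ∀ {t} → Value t → GenN t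
    a   : ∀ {t} → GenA t → GenN t
    λna : ∀ {n a} → GenN n → GenA a → GenN (app (lam n) a)

mutual
  ∣_∣₀ᵃ : ∀ {t} → GenA t → ℕ
  ∣ xv x _ ∣₀ᵃ = 1
  ∣ xa x g ∣₀ᵃ = suc ∣ g ∣₀ᵃ
  ∣ an g h ∣₀ᵃ = suc (∣ g ∣₀ᵃ + ∣ h ∣₀)

  ∣_∣₀ : ∀ {t} → GenN t → ℕ
  ∣ v _ ∣₀      = 0
  ∣ a g ∣₀      = ∣ g ∣₀ᵃ
  ∣ λna g h ∣₀  = suc (∣ g ∣₀ + ∣ h ∣₀ᵃ)

-- Positive types: finite multisets of pairs of positive types,
-- represented by lists taken up to (nested) multiset equivalence ≈.

data Ty : Set where
  mset : List (Ty × Ty) → Ty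

mutual
  data _≈_ : Ty → Ty → Set where
    mset≈ : ∀ {xs ys} → xs ≋ ys → mset xs ≈ mset ys

  data _≋_ : List (Ty × Ty) → List (Ty × Ty) → Set where
    []  : [] ≋ []
    ins : ∀ {P Q P' Q' xs ys zs} → P ≈ P' → Q ≈ Q' → xs ≋ (ys ++ zs) →
          ((P , Q) ∷ xs) ≋ (ys ++ (P' , Q') ∷ zs)

𝟎 : Ty
𝟎 = mset []

_⊎_ : Ty → Ty → Ty
mset xs ⊎ mset ys = mset (xs ++ ys)

Env : Set
Env = ℕ → Ty

_⊎ₑ_ : Env → Env → Env
(Γ ⊎ₑ Δ) y = Γ y ⊎ Δ y

∅ : Env
∅ _ = 𝟎

[_∶_] : ℕ → Ty → Env
[ x ∶ P ] y = if x ≡ᵇ y then P else 𝟎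

tail : Env → Env
tail Γ y = Γ (suc y)

_≈ₑ_ : Env → Env → Set
Γ ≈ₑ Δ = ∀ y → Γ y ≈ Δ y

-- Typing derivations (judgements taken up to multiset equivalence)

mutual
  data _⊢_∶_ : Env → Term → Ty → Set where
    ax  : ∀ {Γ x P} → Γ ≈ₑ [ x ∶ P ] → Γ ⊢ var x ∶ P
    -- (λ): premises Γᵢ , x:Pᵢ ⊢ t : Qᵢ (i = 1..n, n ≥ 0)
    lam : ∀ {Γ Δ t L} → Prems t Δ L → Γ ≈ₑ Δ → Γ ⊢ lam t ∶ mset L
    app : ∀ {Γ Γ₁ Γ₂ t u P P' Q} →
          Γ₁ ⊢ t ∶ mset ((P , Q) ∷ []) → Γ₂ ⊢ u ∶ P' → P ≈ P' →
          Γ ≈ₑ (Γ₁ ⊎ₑ Γ₂) → Γ ⊢ app t u ∶ Q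

  -- a list of premises Γ'ᵢ ⊢ t : Qᵢ where Γ'ᵢ = Γᵢ , x : Γ'ᵢ(0)
  data Prems (t : Term) : Env → List (Ty × Ty) → Set where
    []  : Prems t ∅ []
    _∷_ : ∀ {Γ' Q Δ L} → Γ' ⊢ t ∶ Q → Prems t Δ L →
          Prems t (tail Γ' ⊎ₑ Δ) ((Γ' zero , Q) ∷ L)

mutual
  size : ∀ {Γ t Q} → Γ ⊢ t ∶ Q → ℕ
  size (ax _)          = 0
  size (lam ps _)      = sizeP ps
  size (app π ρ _ _)   = suc (size π + size ρ)

  sizeP : ∀ {t Δ L} → Prems t Δ L → ℕ
  sizeP []       = 0
  sizeP (π ∷ ps) = size π + sizeP ps

Deriv : Term → Set
Deriv t = Σ Env λ Γ → Σ Ty λ Q → Γ ⊢ t ∶ Q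

∣_∣ : ∀ {t} → Deriv t → ℕ
∣ (_ , _ , π) ∣ = size π

Minimal : ∀ {t} → Deriv t → Set
Minimal {t} π = ∀ (π' : Deriv t) → ∣ π ∣ Data.Nat.≤ ∣ π' ∣
  where import Data.Nat

-- A ▷βv-step removes exactly one (@) rule from a derivation and a σ-step removes none;
-- conversely, every derivation of the reduct lifts to a derivation of the redex that is
-- larger by the same amount. The βv case rests on a substitution lemma and its converse,
-- which work because a derivation of a value with type P ⊎ P' splits into derivations
-- with types P and P' whose sizes add up. For a normal form generated by n, every
-- derivation has at least |t₀|₀ (@) rules, and one with exactly |t₀|₀ exists: give every
-- argument the type 𝟎, which a value receives for free. Carried along d, the two bounds
-- show that minimal derivations of t have size |d|βv + |t₀|₀; the empty sequence gives
-- |π₀| = |t₀|₀, and |v|₀ = 0.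

module Submission where

open import Defs
open import Data.Nat using (ℕ; _+_)
open import Data.Product using (_×_)
open import Relation.Binary.PropositionalEquality using (_≡_)

open import Algebra.Bundles using (CommutativeMonoid)
open import Data.Bool using (true; false)
open import Data.Empty using (⊥-elim)
open import Data.List using (List; []; _∷_; _++_)
open import Data.List.Properties using (++-assoc; ++-identityʳ; ∷-injective)
open import Data.Nat using (zero; suc; _≡ᵇ_; _<_; _≤_; s≤s; z≤n)
open import Data.Nat.Properties
  using (+-assoc; +-identityʳ; <-cmp; <⇒≢; >⇒≢; ≤-trans; ≤-reflexive; ≤-antisym;
         m≤n+m; m≤m+n; +-mono-≤; +-monoʳ-≤; +-commutativeSemigroup)
open import Data.Nat.Tactic.RingSolver using (solve-∀)
open import Data.Product using (Σ; _,_)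
open import Data.Sum using (inj₁; inj₂) renaming (_⊎_ to _⊎ˢ_)
open import Relation.Binary.Definitions using (Tri; tri<; tri≈; tri>)
open import Relation.Binary.PropositionalEquality
  using (refl; sym; trans; cong; cong₂; module ≡-Reasoning) renaming (subst to ≡-subst)
open import Relation.Nullary using (¬_)
open ≡-Reasoning

-- Multiset equivalence of positive types

Pair : Set
Pair = Ty × Ty

mutual
  ≈-refl : ∀ {A} → A ≈ A
  ≈-refl {mset xs} = mset≈ ≋-refl

  ≋-refl : ∀ {xs} → xs ≋ xs
  ≋-refl {[]}          = []
  ≋-refl {(P , Q) ∷ xs} = ins {ys = []} ≈-refl ≈-refl ≋-refl

≈-reflexive : ∀ {A B} → A ≡ B → A ≈ B
≈-reflexive refl = ≈-refl

≋-shift : ∀ ys {zs M P Q P' Q'} → (ys ++ zs) ≋ M → P' ≈ P → Q' ≈ Q →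
          (ys ++ (P' , Q') ∷ zs) ≋ ((P , Q) ∷ M)
≋-shift []       r p q = ins {ys = []} p q r
≋-shift (_ ∷ ys) (ins {ys = as} p₁ p₂ r) p q = ins {ys = _ ∷ as} p₁ p₂ (≋-shift ys r p q)

mutual
  ≈-sym : ∀ {A B} → A ≈ B → B ≈ A
  ≈-sym (mset≈ p) = mset≈ (≋-sym p)

  ≋-sym : ∀ {xs ys} → xs ≋ ys → ys ≋ xs
  ≋-sym []                    = []
  ≋-sym (ins {ys = ys} p q r) = ≋-shift ys (≋-sym r) (≈-sym p) (≈-sym q)

++-≡-++∷-inv : ∀ {A : Set} (vs₁ vs₂ us₁ us₂ : List A) e → vs₁ ++ vs₂ ≡ us₁ ++ e ∷ us₂ →
  (Σ _ λ m → vs₁ ≡ us₁ ++ e ∷ m × us₂ ≡ m ++ vs₂) ⊎ˢ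
  (Σ _ λ m → vs₂ ≡ m ++ e ∷ us₂ × us₁ ≡ vs₁ ++ m)
++-≡-++∷-inv []        vs₂ us₁       us₂ e eq   = inj₂ (us₁ , eq , refl)
++-≡-++∷-inv (_ ∷ vs₁) vs₂ []        us₂ e refl = inj₁ (vs₁ , refl , refl)
++-≡-++∷-inv (h ∷ vs₁) vs₂ (_ ∷ us₁) us₂ e eq with ∷-injective eq
... | refl , eq' with ++-≡-++∷-inv vs₁ vs₂ us₁ us₂ e eq'
...   | inj₁ (m , p , q) = inj₁ (m , cong (h ∷_) p , q)
...   | inj₂ (m , p , q) = inj₂ (m , p , cong (h ∷_) q)

≋-dropMiddle : ∀ ys {zs ws P Q} → (ys ++ (P , Q) ∷ zs) ≋ ws →
  Σ _ λ ws₁ → Σ _ λ ws₂ → Σ Ty λ P' → Σ Ty λ Q' →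
  (ws ≡ ws₁ ++ (P' , Q') ∷ ws₂) × P ≈ P' × Q ≈ Q' × ((ys ++ zs) ≋ (ws₁ ++ ws₂))
≋-dropMiddle [] (ins {ys = as} {zs = bs} p q r) = as , bs , _ , _ , refl , p , q , r
≋-dropMiddle (_ ∷ ys) (ins {P' = Y₁} {Q' = Y₂} {ys = vs₁} {zs = vs₂} p₁ p₂ r)
  with ≋-dropMiddle ys r
... | us₁ , us₂ , P' , Q' , eq , p , q , r' with ++-≡-++∷-inv vs₁ vs₂ us₁ us₂ _ eq
...   | inj₁ (m , refl , refl) =
  us₁ , m ++ (Y₁ , Y₂) ∷ vs₂ , P' , Q' , ++-assoc us₁ ((P' , Q') ∷ m) ((Y₁ , Y₂) ∷ vs₂) , p , q ,
  ≡-subst (_ ≋_) (++-assoc us₁ m ((Y₁ , Y₂) ∷ vs₂))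
    (ins {ys = us₁ ++ m} p₁ p₂ (≡-subst (_ ≋_) (sym (++-assoc us₁ m vs₂)) r'))
...   | inj₂ (m , refl , refl) =
  vs₁ ++ (Y₁ , Y₂) ∷ m , us₂ , P' , Q' , sym (++-assoc vs₁ ((Y₁ , Y₂) ∷ m) ((P' , Q') ∷ us₂)) , p , q ,
  ≡-subst (_ ≋_) (sym (++-assoc vs₁ ((Y₁ , Y₂) ∷ m) us₂))
    (ins {ys = vs₁} {zs = m ++ us₂} p₁ p₂ (≡-subst (_ ≋_) (++-assoc vs₁ m us₂) r'))

mutual
  ≈-trans : ∀ {A B C} → A ≈ B → B ≈ C → A ≈ C
  ≈-trans (mset≈ p) (mset≈ q) = mset≈ (≋-trans p q)

  ≋-trans : ∀ {xs ys zs} → xs ≋ ys → ys ≋ zs → xs ≋ zs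
  ≋-trans [] q = q
  ≋-trans (ins {ys = ys} p₁ p₂ r) q with ≋-dropMiddle ys q
  ... | _ , _ , _ , _ , refl , p , p' , q' = ins (≈-trans p₁ p) (≈-trans p₂ p') (≋-trans r q')

≋-++ : ∀ {xs xs' ys ys'} → xs ≋ xs' → ys ≋ ys' → (xs ++ ys) ≋ (xs' ++ ys')
≋-++ [] q = q
≋-++ {ys' = ys'} (ins {P' = P'} {Q' = Q'} {ys = as} {zs = bs} p₁ p₂ r) q =
  ≡-subst (_ ≋_) (sym (++-assoc as ((P' , Q') ∷ bs) ys'))
    (ins {ys = as} p₁ p₂ (≡-subst (_ ≋_) (++-assoc as bs ys') (≋-++ r q)))

≋-++-comm : ∀ xs ys → (xs ++ ys) ≋ (ys ++ xs)
≋-++-comm []             ys = ≡-subst (ys ≋_) (sym (++-identityʳ ys)) ≋-refl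
≋-++-comm ((P , Q) ∷ xs) ys = ins {ys = ys} ≈-refl ≈-refl (≋-++-comm xs ys)

⊎-cong : ∀ {A A' B B'} → A ≈ A' → B ≈ B' → (A ⊎ B) ≈ (A' ⊎ B')
⊎-cong (mset≈ p) (mset≈ q) = mset≈ (≋-++ p q)

⊎-comm : ∀ A B → (A ⊎ B) ≈ (B ⊎ A)
⊎-comm (mset xs) (mset ys) = mset≈ (≋-++-comm xs ys)

⊎-assoc : ∀ A B C → ((A ⊎ B) ⊎ C) ≈ (A ⊎ (B ⊎ C))
⊎-assoc (mset xs) (mset ys) (mset zs) = ≈-reflexive (cong mset (++-assoc xs ys zs))

⊎-identityˡ : ∀ A → (𝟎 ⊎ A) ≈ A
⊎-identityˡ (mset xs) = ≈-refl

⊎-identityʳ : ∀ A → (A ⊎ 𝟎) ≈ A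
⊎-identityʳ (mset xs) = ≈-reflexive (cong mset (++-identityʳ xs))

≈ₑ-refl : ∀ {Γ} → Γ ≈ₑ Γ
≈ₑ-refl _ = ≈-refl

≈ₑ-sym : ∀ {Γ Δ} → Γ ≈ₑ Δ → Δ ≈ₑ Γ
≈ₑ-sym p y = ≈-sym (p y)

≈ₑ-trans : ∀ {Γ Δ Θ} → Γ ≈ₑ Δ → Δ ≈ₑ Θ → Γ ≈ₑ Θ
≈ₑ-trans p q y = ≈-trans (p y) (q y)

⊎ₑ-cong : ∀ {Γ Γ' Δ Δ'} → Γ ≈ₑ Γ' → Δ ≈ₑ Δ' → (Γ ⊎ₑ Δ) ≈ₑ (Γ' ⊎ₑ Δ')
⊎ₑ-cong p q y = ⊎-cong (p y) (q y)

⊎ₑ-assoc : ∀ Γ Δ Θ → ((Γ ⊎ₑ Δ) ⊎ₑ Θ) ≈ₑ (Γ ⊎ₑ (Δ ⊎ₑ Θ))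
⊎ₑ-assoc Γ Δ Θ y = ⊎-assoc (Γ y) (Δ y) (Θ y)

⊎ₑ-identityˡ : ∀ Γ → (∅ ⊎ₑ Γ) ≈ₑ Γ
⊎ₑ-identityˡ Γ y = ⊎-identityˡ (Γ y)

⊎ₑ-identityʳ : ∀ Γ → (Γ ⊎ₑ ∅) ≈ₑ Γ
⊎ₑ-identityʳ Γ y = ⊎-identityʳ (Γ y)

⊎ₑ-commutativeMonoid : CommutativeMonoid _ _
⊎ₑ-commutativeMonoid = record
  { Carrier = Env ; _≈_ = _≈ₑ_ ; _∙_ = _⊎ₑ_ ; ε = ∅
  ; isCommutativeMonoid = record
    { isMonoid = record
      { isSemigroup = record
        { isMagma = record
          { isEquivalence = record { refl = ≈ₑ-refl ; sym = ≈ₑ-sym ; trans = ≈ₑ-trans }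
          ; ∙-cong = ⊎ₑ-cong }
        ; assoc = ⊎ₑ-assoc }
      ; identity = ⊎ₑ-identityˡ , ⊎ₑ-identityʳ }
    ; comm = λ Γ Δ y → ⊎-comm (Γ y) (Δ y) } }

open import Algebra.Properties.CommutativeSemigroup (CommutativeMonoid.commutativeSemigroup ⊎ₑ-commutativeMonoid)
  using () renaming (x∙yz≈y∙xz to ⊎ₑ-leftComm; xy∙z≈xz∙y to ⊎ₑ-rightComm; interchange to ⊎ₑ-interchange)
open import Algebra.Properties.CommutativeSemigroup +-commutativeSemigroup
  using () renaming (x∙yz≈y∙xz to +-leftComm; interchange to +-interchange)

+-regroup : ∀ m n {x y r r₁ r₂} → x ≡ m + r₁ → y ≡ n + r₂ → r ≡ r₁ + r₂ → x + y ≡ (m + n) + r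
+-regroup m n {r₁ = r₁} {r₂} refl refl refl = +-interchange m r₁ n r₂

-- Transport of derivations along ≈

infixr 5 _∷ₑ_
_∷ₑ_ : Ty → Env → Env
(P ∷ₑ Γ) zero    = P
(P ∷ₑ Γ) (suc y) = Γ y

∷ₑ-cong : ∀ {P P' Γ Γ'} → P ≈ P' → Γ ≈ₑ Γ' → (P ∷ₑ Γ) ≈ₑ (P' ∷ₑ Γ')
∷ₑ-cong p g zero    = p
∷ₑ-cong p g (suc y) = g y

≈ₑ-∷ₑ-tail : ∀ {Γ P} → Γ zero ≈ P → Γ ≈ₑ (P ∷ₑ tail Γ)
≈ₑ-∷ₑ-tail p zero    = p
≈ₑ-∷ₑ-tail p (suc y) = ≈-refl

tail-cong : ∀ {Γ Γ'} → Γ ≈ₑ Γ' → tail Γ ≈ₑ tail Γ'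
tail-cong g y = g (suc y)

[∶]-cong : ∀ x {P P'} → P ≈ P' → [ x ∶ P ] ≈ₑ [ x ∶ P' ]
[∶]-cong x p y with x ≡ᵇ y
... | true  = p
... | false = ≈-refl

infix 4 _⊢_∶_⟨_⟩
_⊢_∶_⟨_⟩ : Env → Term → Ty → ℕ → Set
Γ ⊢ t ∶ Q ⟨ n ⟩ = Σ (Γ ⊢ t ∶ Q) λ π → size π ≡ n

PremsOfSize : Term → Env → List Pair → ℕ → Set
PremsOfSize t Δ L n = Σ (Prems t Δ L) λ ps → sizeP ps ≡ n

-- Prems fixes the environment of a premise list syntactically, so constructions on
-- premise lists only determine it up to ≈ₑ.
Prems≈ : Term → Env → List Pair → ℕ → Set
Prems≈ t Δ L n = Σ Env λ Δ' → (Δ' ≈ₑ Δ) × PremsOfSize t Δ' L n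

Prems-insert : ∀ ys {t Γ Q Δ zs} → (π : Γ ⊢ t ∶ Q) → (ps : Prems t Δ (ys ++ zs)) →
  Prems≈ t (tail Γ ⊎ₑ Δ) (ys ++ (Γ zero , Q) ∷ zs) (size π + sizeP ps)
Prems-insert []       π ps = _ , ≈ₑ-refl , π ∷ ps , refl
Prems-insert (_ ∷ ys) {Γ = Γ} π (_∷_ {Γ' = Γ₁} π₁ ps) with Prems-insert ys π ps
... | _ , e , ps' , s =
  _ , ≈ₑ-trans (⊎ₑ-cong ≈ₑ-refl e) (⊎ₑ-leftComm (tail Γ₁) (tail Γ) _) , π₁ ∷ ps' ,
  trans (cong (size π₁ +_) s) (+-leftComm (size π₁) (size π) (sizeP ps))

mutual
  ⊢-transport : ∀ {Γ Γ' t Q Q'} → (π : Γ ⊢ t ∶ Q) → Γ ≈ₑ Γ' → Q ≈ Q' → Γ' ⊢ t ∶ Q' ⟨ size π ⟩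
  ⊢-transport (ax {x = x} e) g q = ax (≈ₑ-trans (≈ₑ-sym g) (≈ₑ-trans e ([∶]-cong x q))) , refl
  ⊢-transport (lam ps e) g (mset≈ q) with Prems-transport ps q
  ... | _ , e' , ps' , s = lam ps' (≈ₑ-trans (≈ₑ-sym g) (≈ₑ-trans e (≈ₑ-sym e'))) , s
  ⊢-transport (app π ρ p e) g q with ⊢-transport π ≈ₑ-refl (mset≈ (ins {ys = []} ≈-refl q []))
  ... | π' , s = app π' ρ p (≈ₑ-trans (≈ₑ-sym g) e) , cong (λ n → suc (n + size ρ)) s

  Prems-transport : ∀ {t Δ L L'} → (ps : Prems t Δ L) → L ≋ L' → Prems≈ t Δ L' (sizeP ps)
  Prems-transport [] [] = ∅ , ≈ₑ-refl , [] , refl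
  Prems-transport (π ∷ ps) (ins {ys = ys} p q r) with Prems-transport ps r
  ... | _ , e₁ , ps₁ , s₁ with ⊢-transport π (≈ₑ-∷ₑ-tail p) q
  ...   | π' , s with Prems-insert ys π' ps₁
  ...     | _ , e₂ , ps₂ , s₂ =
    _ , ≈ₑ-trans e₂ (⊎ₑ-cong ≈ₑ-refl e₁) , ps₂ , trans s₂ (cong₂ _+_ s s₁)

⊢-transport-env : ∀ {Γ Γ' t Q} → (π : Γ ⊢ t ∶ Q) → Γ ≈ₑ Γ' → Γ' ⊢ t ∶ Q ⟨ size π ⟩
⊢-transport-env π g = ⊢-transport π g ≈-refl

-- Weakening

skip : ℕ → ℕ → ℕ
skip zero    = suc
skip (suc k) = ext (skip k)

insertEnv : ℕ → Env → Env
insertEnv zero    Γ = 𝟎 ∷ₑ Γ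
insertEnv (suc k) Γ = Γ zero ∷ₑ insertEnv k (tail Γ)

insertEnv-cong : ∀ k {Γ Γ'} → Γ ≈ₑ Γ' → insertEnv k Γ ≈ₑ insertEnv k Γ'
insertEnv-cong zero    g = ∷ₑ-cong ≈-refl g
insertEnv-cong (suc k) g = ∷ₑ-cong (g zero) (insertEnv-cong k (tail-cong g))

insertEnv-⊎ₑ : ∀ k Γ Δ → insertEnv k (Γ ⊎ₑ Δ) ≈ₑ (insertEnv k Γ ⊎ₑ insertEnv k Δ)
insertEnv-⊎ₑ zero    Γ Δ zero    = ≈-refl
insertEnv-⊎ₑ zero    Γ Δ (suc y) = ≈-refl
insertEnv-⊎ₑ (suc k) Γ Δ zero    = ≈-refl
insertEnv-⊎ₑ (suc k) Γ Δ (suc y) = insertEnv-⊎ₑ k (tail Γ) (tail Δ) y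

insertEnv-∅ : ∀ k → insertEnv k ∅ ≈ₑ ∅
insertEnv-∅ zero    zero    = ≈-refl
insertEnv-∅ zero    (suc y) = ≈-refl
insertEnv-∅ (suc k) zero    = ≈-refl
insertEnv-∅ (suc k) (suc y) = insertEnv-∅ k y

insertEnv-[∶] : ∀ k x P → insertEnv k [ x ∶ P ] ≈ₑ [ skip k x ∶ P ]
insertEnv-[∶] zero    x       P zero    = ≈-refl
insertEnv-[∶] zero    x       P (suc y) = ≈-refl
insertEnv-[∶] (suc k) zero    P zero    = ≈-refl
insertEnv-[∶] (suc k) zero    P (suc y) = insertEnv-∅ k y
insertEnv-[∶] (suc k) (suc x) P zero    = ≈-refl
insertEnv-[∶] (suc k) (suc x) P (suc y) = insertEnv-[∶] k x P y

mutual
  ⊢-weaken : ∀ k {Γ t Q} → (π : Γ ⊢ t ∶ Q) → insertEnv k Γ ⊢ rename (skip k) t ∶ Q ⟨ size π ⟩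
  ⊢-weaken k (ax {x = x} {P = P} e) = ax (≈ₑ-trans (insertEnv-cong k e) (insertEnv-[∶] k x P)) , refl
  ⊢-weaken k (lam ps e) with Prems-weaken k ps
  ... | _ , e' , ps' , s = lam ps' (≈ₑ-trans (insertEnv-cong k e) (≈ₑ-sym e')) , s
  ⊢-weaken k (app {Γ₁ = Γ₁} {Γ₂ = Γ₂} π ρ p e) with ⊢-weaken k π | ⊢-weaken k ρ
  ... | π' , s | ρ' , s' =
    app π' ρ' p (≈ₑ-trans (insertEnv-cong k e) (insertEnv-⊎ₑ k Γ₁ Γ₂)) , cong₂ (λ m n → suc (m + n)) s s'

  Prems-weaken : ∀ k {t Δ L} → (ps : Prems t Δ L) →
                 Prems≈ (rename (skip (suc k)) t) (insertEnv k Δ) L (sizeP ps)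
  Prems-weaken k [] = ∅ , ≈ₑ-sym (insertEnv-∅ k) , [] , refl
  Prems-weaken k (_∷_ {Γ' = Γ'} π ps) with ⊢-weaken (suc k) π | Prems-weaken k ps
  ... | π' , s | _ , e , ps' , s' =
    _ , ≈ₑ-trans (⊎ₑ-cong ≈ₑ-refl e) (≈ₑ-sym (insertEnv-⊎ₑ k (tail Γ') _)) , π' ∷ ps' , cong₂ _+_ s s'

mutual
  ⊢-strengthen : ∀ k t {Γ Q} → (π : Γ ⊢ rename (skip k) t ∶ Q) →
                 Σ Env λ Γ₀ → (Γ ≈ₑ insertEnv k Γ₀) × Γ₀ ⊢ t ∶ Q ⟨ size π ⟩
  ⊢-strengthen k (var x) (ax {P = P} e) = _ , ≈ₑ-trans e (≈ₑ-sym (insertEnv-[∶] k x P)) , ax ≈ₑ-refl , refl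
  ⊢-strengthen k (lam t) (lam ps e) with Prems-strengthen k t ps
  ... | _ , e' , ps₀ , s = _ , ≈ₑ-trans e e' , lam ps₀ ≈ₑ-refl , s
  ⊢-strengthen k (app t u) (app π ρ p e) with ⊢-strengthen k t π | ⊢-strengthen k u ρ
  ... | Γ₁ , e₁ , π₀ , s₁ | Γ₂ , e₂ , ρ₀ , s₂ =
    _ , ≈ₑ-trans e (≈ₑ-trans (⊎ₑ-cong e₁ e₂) (≈ₑ-sym (insertEnv-⊎ₑ k Γ₁ Γ₂))) ,
    app π₀ ρ₀ p ≈ₑ-refl , cong₂ (λ m n → suc (m + n)) s₁ s₂

  Prems-strengthen : ∀ k t {Δ L} → (ps : Prems (rename (skip (suc k)) t) Δ L) →
                     Σ Env λ Δ₀ → (Δ ≈ₑ insertEnv k Δ₀) × PremsOfSize t Δ₀ L (sizeP ps)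
  Prems-strengthen k t [] = ∅ , ≈ₑ-sym (insertEnv-∅ k) , [] , refl
  Prems-strengthen k t (_∷_ {Γ' = Γ'} π ps) with ⊢-strengthen (suc k) t π | Prems-strengthen k t ps
  ... | Γ₀ , g , π₀ , s | Δ₀ , e , ps₀ , s' with ⊢-transport-env π₀ (≈ₑ-∷ₑ-tail {P = Γ' zero} (≈-sym (g zero)))
  ...   | π₁ , s₁ =
    _ , ≈ₑ-trans (⊎ₑ-cong (tail-cong g) e) (≈ₑ-sym (insertEnv-⊎ₑ k (tail Γ₀) Δ₀)) ,
    π₁ ∷ ps₀ , cong₂ _+_ (trans s₁ s) s'

-- Derivations of values

[∶]-⊎ : ∀ x A B → ([ x ∶ A ] ⊎ₑ [ x ∶ B ]) ≈ₑ [ x ∶ A ⊎ B ]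
[∶]-⊎ x A B y with x ≡ᵇ y
... | true  = ≈-refl
... | false = ≈-refl

[∶]-𝟎 : ∀ x → [ x ∶ 𝟎 ] ≈ₑ ∅
[∶]-𝟎 x y with x ≡ᵇ y
... | true  = ≈-refl
... | false = ≈-refl

≋-[]-inv : ∀ {xs ys} → xs ≋ ys → ys ≡ [] → xs ≡ []
≋-[]-inv []                     _  = refl
≋-[]-inv (ins {ys = []} _ _ _)    ()
≋-[]-inv (ins {ys = _ ∷ _} _ _ _) ()

value-⊢𝟎 : ∀ {w} → Value w → ∅ ⊢ w ∶ 𝟎 ⟨ 0 ⟩
value-⊢𝟎 (var x) = ax (≈ₑ-sym ([∶]-𝟎 x)) , refl
value-⊢𝟎 (lam t) = lam [] ≈ₑ-refl , refl

value-⊢𝟎-inv : ∀ {w Δ P} → Value w → (π : Δ ⊢ w ∶ P) → P ≈ 𝟎 → (Δ ≈ₑ ∅) × (size π ≡ 0)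
value-⊢𝟎-inv (var x) (ax e) p = ≈ₑ-trans e (≈ₑ-trans ([∶]-cong x p) ([∶]-𝟎 x)) , refl
value-⊢𝟎-inv (lam t) (lam ps e) (mset≈ q) with ≋-[]-inv q refl
value-⊢𝟎-inv (lam t) (lam [] e) (mset≈ q) | refl = e , refl

Prems-split : ∀ L₁ {t Δ L₂} → (ps : Prems t Δ (L₁ ++ L₂)) →
  Σ Env λ Δ₁ → Σ Env λ Δ₂ → Σ (Prems t Δ₁ L₁) λ ps₁ → Σ (Prems t Δ₂ L₂) λ ps₂ →
  (Δ ≈ₑ (Δ₁ ⊎ₑ Δ₂)) × (sizeP ps ≡ sizeP ps₁ + sizeP ps₂)
Prems-split [] ps = ∅ , _ , [] , ps , ≈ₑ-sym (⊎ₑ-identityˡ _) , refl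
Prems-split (_ ∷ L₁) (_∷_ {Γ' = Γ} π ps) with Prems-split L₁ ps
... | Δ₁ , Δ₂ , ps₁ , ps₂ , e , s =
  _ , Δ₂ , π ∷ ps₁ , ps₂ , ≈ₑ-trans (⊎ₑ-cong ≈ₑ-refl e) (≈ₑ-sym (⊎ₑ-assoc (tail Γ) Δ₁ Δ₂)) ,
  trans (cong (size π +_) s) (sym (+-assoc (size π) (sizeP ps₁) (sizeP ps₂)))

Prems-++ : ∀ {t Δ₁ Δ₂ L₁ L₂} → (ps₁ : Prems t Δ₁ L₁) → (ps₂ : Prems t Δ₂ L₂) →
  Prems≈ t (Δ₁ ⊎ₑ Δ₂) (L₁ ++ L₂) (sizeP ps₁ + sizeP ps₂)
Prems-++ []                   ps₂ = _ , ≈ₑ-sym (⊎ₑ-identityˡ _) , ps₂ , refl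
Prems-++ (_∷_ {Γ' = Γ} π ps₁) ps₂ with Prems-++ ps₁ ps₂
... | _ , e , ps , s =
  _ , ≈ₑ-trans (⊎ₑ-cong ≈ₑ-refl e) (≈ₑ-sym (⊎ₑ-assoc (tail Γ) _ _)) , π ∷ ps ,
  trans (cong (size π +_) s) (sym (+-assoc (size π) (sizeP ps₁) (sizeP ps₂)))

value-split : ∀ {w Δ P} A B → Value w → (π : Δ ⊢ w ∶ P) → P ≈ (A ⊎ B) →
  Σ Env λ Δ₁ → Σ Env λ Δ₂ → Σ (Δ₁ ⊢ w ∶ A) λ π₁ → Σ (Δ₂ ⊢ w ∶ B) λ π₂ →
  (Δ ≈ₑ (Δ₁ ⊎ₑ Δ₂)) × (size π ≡ size π₁ + size π₂)
value-split A B (var x) (ax e) p =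
  _ , _ , ax ≈ₑ-refl , ax ≈ₑ-refl , ≈ₑ-trans e (≈ₑ-trans ([∶]-cong x p) (≈ₑ-sym ([∶]-⊎ x A B))) , refl
value-split (mset L₁) (mset L₂) (lam t) (lam ps e) (mset≈ q) with Prems-transport ps q
... | _ , e' , ps' , s with Prems-split L₁ ps'
...   | Δ₁ , Δ₂ , ps₁ , ps₂ , e'' , s' =
  Δ₁ , Δ₂ , lam ps₁ ≈ₑ-refl , lam ps₂ ≈ₑ-refl , ≈ₑ-trans e (≈ₑ-trans (≈ₑ-sym e') e'') , trans (sym s) s'

value-merge : ∀ {w Δ₁ Δ₂ A B} → Value w → (π₁ : Δ₁ ⊢ w ∶ A) → (π₂ : Δ₂ ⊢ w ∶ B) →
  (Δ₁ ⊎ₑ Δ₂) ⊢ w ∶ (A ⊎ B) ⟨ size π₁ + size π₂ ⟩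
value-merge {A = A} {B = B} (var x) (ax e₁) (ax e₂) = ax (≈ₑ-trans (⊎ₑ-cong e₁ e₂) ([∶]-⊎ x A B)) , refl
value-merge (lam t) (lam ps₁ e₁) (lam ps₂ e₂) with Prems-++ ps₁ ps₂
... | _ , e , ps , s = lam ps (≈ₑ-trans (⊎ₑ-cong e₁ e₂) (≈ₑ-sym e)) , s

-- The substitution lemma and its converse

Substitutes : ℕ → (ℕ → Term) → Term → Set
Substitutes k τ w = (∀ y → y < k → τ y ≡ var y) × (τ k ≡ w) × (∀ y → k ≤ y → τ (suc y) ≡ var y)

exts-Substitutes : ∀ {k τ w} → Substitutes k τ w → Substitutes (suc k) (exts τ) (↑ w)
exts-Substitutes (below , at , above) =
  (λ { zero _ → refl ; (suc y) (s≤s y<k) → cong ↑ (below y y<k) }) ,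
  cong ↑ at ,
  (λ { (suc y) (s≤s k≤y) → cong ↑ (above y k≤y) })

value-rename : ∀ {w} ρ → Value w → Value (rename ρ w)
value-rename ρ (var x) = var _
value-rename ρ (lam t) = lam _

removeEnv : ℕ → Env → Env
removeEnv zero    Γ = tail Γ
removeEnv (suc k) Γ = Γ zero ∷ₑ removeEnv k (tail Γ)

removeEnv-cong : ∀ k {Γ Γ'} → Γ ≈ₑ Γ' → removeEnv k Γ ≈ₑ removeEnv k Γ'
removeEnv-cong zero    g = tail-cong g
removeEnv-cong (suc k) g = ∷ₑ-cong (g zero) (removeEnv-cong k (tail-cong g))

removeEnv-⊎ₑ : ∀ k Γ Δ → removeEnv k (Γ ⊎ₑ Δ) ≈ₑ (removeEnv k Γ ⊎ₑ removeEnv k Δ)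
removeEnv-⊎ₑ zero    Γ Δ y       = ≈-refl
removeEnv-⊎ₑ (suc k) Γ Δ zero    = ≈-refl
removeEnv-⊎ₑ (suc k) Γ Δ (suc y) = removeEnv-⊎ₑ k (tail Γ) (tail Δ) y

removeEnv-∅ : ∀ k → removeEnv k ∅ ≈ₑ ∅
removeEnv-∅ zero    y       = ≈-refl
removeEnv-∅ (suc k) zero    = ≈-refl
removeEnv-∅ (suc k) (suc y) = removeEnv-∅ k y

removeEnv-[∶]< : ∀ k x P → x < k → removeEnv k [ x ∶ P ] ≈ₑ [ x ∶ P ]
removeEnv-[∶]< (suc k) zero    P _         zero    = ≈-refl
removeEnv-[∶]< (suc k) zero    P _         (suc y) = removeEnv-∅ k y
removeEnv-[∶]< (suc k) (suc x) P _         zero    = ≈-refl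
removeEnv-[∶]< (suc k) (suc x) P (s≤s x<k) (suc y) = removeEnv-[∶]< k x P x<k y

removeEnv-[∶]≡ : ∀ k P → removeEnv k [ k ∶ P ] ≈ₑ ∅
removeEnv-[∶]≡ zero    P y       = ≈-refl
removeEnv-[∶]≡ (suc k) P zero    = ≈-refl
removeEnv-[∶]≡ (suc k) P (suc y) = removeEnv-[∶]≡ k P y

removeEnv-[∶]> : ∀ k x P → k ≤ x → removeEnv k [ suc x ∶ P ] ≈ₑ [ x ∶ P ]
removeEnv-[∶]> zero    x       P _         y       = ≈-refl
removeEnv-[∶]> (suc k) (suc x) P (s≤s k≤x) zero    = ≈-refl
removeEnv-[∶]> (suc k) (suc x) P (s≤s k≤x) (suc y) = removeEnv-[∶]> k x P k≤x y

[∶]-self : ∀ x P → [ x ∶ P ] x ≡ P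
[∶]-self zero    P = refl
[∶]-self (suc x) P = [∶]-self x P

[∶]-other : ∀ x k P → ¬ (x ≡ k) → [ x ∶ P ] k ≡ 𝟎
[∶]-other zero    zero    P x≢k = ⊥-elim (x≢k refl)
[∶]-other zero    (suc k) P x≢k = refl
[∶]-other (suc x) zero    P x≢k = refl
[∶]-other (suc x) (suc k) P x≢k = [∶]-other x k P (λ eq → x≢k (cong suc eq))

⊢-≡ : ∀ {Γ u u' Q n} → u ≡ u' → Γ ⊢ u ∶ Q ⟨ n ⟩ → Γ ⊢ u' ∶ Q ⟨ n ⟩
⊢-≡ refl π = π

⊢-subst-var : ∀ k x {τ w Γ Q Δ P} → Tri (x < k) (x ≡ k) (k < x) → Substitutes k τ w → Value w →
  Γ ≈ₑ [ x ∶ Q ] → (ρ : Δ ⊢ w ∶ P) → P ≈ Γ k → (removeEnv k Γ ⊎ₑ Δ) ⊢ τ x ∶ Q ⟨ size ρ ⟩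
⊢-subst-var k x {Q = Q} (tri< x<k _ _) (below , _ , _) vw e ρ p
  with value-⊢𝟎-inv vw ρ (≈-trans p (≈-trans (e k) (≈-reflexive ([∶]-other x k Q (<⇒≢ x<k)))))
... | Δ≈∅ , sρ = ⊢-≡ (sym (below x x<k)) (ax env , sym sρ)
  where
  env : (removeEnv k _ ⊎ₑ _) ≈ₑ [ x ∶ Q ]
  env = ≈ₑ-trans (⊎ₑ-cong (≈ₑ-trans (removeEnv-cong k e) (removeEnv-[∶]< k x Q x<k)) Δ≈∅) (⊎ₑ-identityʳ _)
⊢-subst-var k x {Q = Q} {Δ = Δ} (tri≈ _ refl _) (_ , at , _) vw e ρ p =
  ⊢-≡ (sym at) (⊢-transport ρ env (≈-trans p (≈-trans (e x) (≈-reflexive ([∶]-self x Q)))))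
  where
  env : Δ ≈ₑ (removeEnv k _ ⊎ₑ Δ)
  env = ≈ₑ-sym (≈ₑ-trans (⊎ₑ-cong (≈ₑ-trans (removeEnv-cong k e) (removeEnv-[∶]≡ k Q)) ≈ₑ-refl) (⊎ₑ-identityˡ Δ))
⊢-subst-var k (suc x) {Q = Q} (tri> _ _ k<x@(s≤s k≤x)) (_ , _ , above) vw e ρ p
  with value-⊢𝟎-inv vw ρ (≈-trans p (≈-trans (e k) (≈-reflexive ([∶]-other (suc x) k Q (>⇒≢ k<x)))))
... | Δ≈∅ , sρ = ⊢-≡ (sym (above x k≤x)) (ax env , sym sρ)
  where
  env : (removeEnv k _ ⊎ₑ _) ≈ₑ [ x ∶ Q ]
  env = ≈ₑ-trans (⊎ₑ-cong (≈ₑ-trans (removeEnv-cong k e) (removeEnv-[∶]> k x Q k≤x)) Δ≈∅) (⊎ₑ-identityʳ _)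

mutual
  ⊢-subst : ∀ {k τ w Γ t Q Δ P} → Substitutes k τ w → Value w →
    (π : Γ ⊢ t ∶ Q) → (ρ : Δ ⊢ w ∶ P) → P ≈ Γ k →
    (removeEnv k Γ ⊎ₑ Δ) ⊢ subst τ t ∶ Q ⟨ size π + size ρ ⟩
  ⊢-subst {k} sub vw (ax {x = x} e) ρ p = ⊢-subst-var k x (<-cmp x k) sub vw e ρ p
  ⊢-subst {k} sub vw (lam ps e) ρ p with Prems-subst sub vw ps ρ (≈-trans p (e k))
  ... | _ , eΘ , ps' , s = lam ps' (≈ₑ-trans (⊎ₑ-cong (removeEnv-cong k e) ≈ₑ-refl) (≈ₑ-sym eΘ)) , s
  ⊢-subst {k} {Δ = Δ} sub vw (app {Γ₁ = Γ₁} {Γ₂ = Γ₂} π₁ π₂ q e) ρ p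
    with value-split (Γ₁ k) (Γ₂ k) vw ρ (≈-trans p (e k))
  ... | Δ₁ , Δ₂ , ρ₁ , ρ₂ , eΔ , sρ with ⊢-subst sub vw π₁ ρ₁ ≈-refl | ⊢-subst sub vw π₂ ρ₂ ≈-refl
  ...   | π₁' , s₁ | π₂' , s₂ = app π₁' π₂' q env , cong suc size≡
    where
    env : (removeEnv k _ ⊎ₑ Δ) ≈ₑ ((removeEnv k Γ₁ ⊎ₑ Δ₁) ⊎ₑ (removeEnv k Γ₂ ⊎ₑ Δ₂))
    env = ≈ₑ-trans (⊎ₑ-cong (≈ₑ-trans (removeEnv-cong k e) (removeEnv-⊎ₑ k Γ₁ Γ₂)) eΔ)
                   (⊎ₑ-interchange (removeEnv k Γ₁) (removeEnv k Γ₂) Δ₁ Δ₂)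
    size≡ : size π₁' + size π₂' ≡ (size π₁ + size π₂) + size ρ
    size≡ = +-regroup (size π₁) (size π₂) s₁ s₂ sρ

  Prems-subst : ∀ {k τ w t Δps L Δ P} → Substitutes k τ w → Value w →
    (ps : Prems t Δps L) → (ρ : Δ ⊢ w ∶ P) → P ≈ Δps k →
    Prems≈ (subst (exts τ) t) (removeEnv k Δps ⊎ₑ Δ) L (sizeP ps + size ρ)
  Prems-subst {k} sub vw [] ρ p with value-⊢𝟎-inv vw ρ p
  ... | Δ≈∅ , sρ = ∅ , ≈ₑ-sym (≈ₑ-trans (⊎ₑ-cong (removeEnv-∅ k) Δ≈∅) (⊎ₑ-identityʳ ∅)) , [] , sym sρ
  Prems-subst {k} sub vw (_∷_ {Γ' = Γ} {Δ = Δr} π ps) ρ p with value-split (Γ (suc k)) (Δr k) vw ρ p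
  ... | Δ₁ , Δ₂ , ρ₁ , ρ₂ , eΔ , sρ with ⊢-weaken 0 ρ₁ | Prems-subst sub vw ps ρ₂ ≈-refl
  ...   | ρ₁' , sρ₁' | _ , eΘ , ps' , s with ⊢-subst (exts-Substitutes sub) (value-rename suc vw) π ρ₁' ≈-refl
  ...     | π' , sπ with ⊢-transport-env π' (≈ₑ-∷ₑ-tail {P = Γ zero} (⊎-identityʳ _))
  ...       | π'' , s'' = _ , env , π'' ∷ ps' , size≡
    where
    env : ((removeEnv k (tail Γ) ⊎ₑ Δ₁) ⊎ₑ _) ≈ₑ (removeEnv k (tail Γ ⊎ₑ Δr) ⊎ₑ _)
    env = ≈ₑ-trans (⊎ₑ-cong ≈ₑ-refl eΘ)
            (≈ₑ-trans (⊎ₑ-interchange (removeEnv k (tail Γ)) Δ₁ (removeEnv k Δr) Δ₂)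
              (⊎ₑ-cong (≈ₑ-sym (removeEnv-⊎ₑ k (tail Γ) Δr)) (≈ₑ-sym eΔ)))
    size≡ : size π'' + sizeP ps' ≡ (size π + sizeP ps) + size ρ
    size≡ = +-regroup (size π) (sizeP ps) (trans s'' (trans sπ (cong (size π +_) sρ₁'))) s sρ

⊢-var-inv : ∀ {u y Γ Q} → u ≡ var y → (π : Γ ⊢ u ∶ Q) → (Γ ≈ₑ [ y ∶ Q ]) × (size π ≡ 0)
⊢-var-inv refl (ax e) = e , refl

record SubstSplit (k : ℕ) (w t : Term) (Γ : Env) (Q : Ty) (n : ℕ) : Set where
  constructor split
  field
    {Γ₀ Δ} : Env
    {P}    : Ty
    body   : Γ₀ ⊢ t ∶ Q
    arg    : Δ ⊢ w ∶ P
    arg≈   : P ≈ Γ₀ k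
    env≈   : Γ ≈ₑ (removeEnv k Γ₀ ⊎ₑ Δ)
    size≡  : n ≡ size body + size arg

record PremsSubstSplit (k : ℕ) (w t : Term) (Δps : Env) (L : List Pair) (n : ℕ) : Set where
  constructor split
  field
    {Δ₀ Δ} : Env
    {P}    : Ty
    body   : Prems t Δ₀ L
    arg    : Δ ⊢ w ∶ P
    arg≈   : P ≈ Δ₀ k
    env≈   : Δps ≈ₑ (removeEnv k Δ₀ ⊎ₑ Δ)
    size≡  : n ≡ sizeP body + size arg

⊢-subst-var-inv : ∀ k x {τ w Γ Q} → Tri (x < k) (x ≡ k) (k < x) → Substitutes k τ w → Value w →
  (π : Γ ⊢ τ x ∶ Q) → SubstSplit k w (var x) Γ Q (size π)
⊢-subst-var-inv k x {Q = Q} (tri< x<k _ _) (below , _ , _) vw π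
  with ⊢-var-inv (below x x<k) π | value-⊢𝟎 vw
... | e , s | ρ , sρ =
  split (ax ≈ₑ-refl) ρ (≈-sym (≈-reflexive ([∶]-other x k Q (<⇒≢ x<k))))
    (≈ₑ-trans e (≈ₑ-trans (≈ₑ-sym (⊎ₑ-identityʳ _)) (⊎ₑ-cong (≈ₑ-sym (removeEnv-[∶]< k x Q x<k)) ≈ₑ-refl)))
    (trans s (sym sρ))
⊢-subst-var-inv k x {Γ = Γ} {Q = Q} (tri≈ _ refl _) (_ , at , _) vw π with ⊢-≡ at (π , refl)
... | ρ , s =
  split (ax ≈ₑ-refl) ρ (≈-sym (≈-reflexive ([∶]-self x Q)))
    (≈ₑ-sym (≈ₑ-trans (⊎ₑ-cong (removeEnv-[∶]≡ k Q) ≈ₑ-refl) (⊎ₑ-identityˡ Γ)))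
    (sym s)
⊢-subst-var-inv k (suc x) {Q = Q} (tri> _ _ k<x@(s≤s k≤x)) (_ , _ , above) vw π
  with ⊢-var-inv (above x k≤x) π | value-⊢𝟎 vw
... | e , s | ρ , sρ =
  split (ax ≈ₑ-refl) ρ (≈-sym (≈-reflexive ([∶]-other (suc x) k Q (>⇒≢ k<x))))
    (≈ₑ-trans e (≈ₑ-trans (≈ₑ-sym (⊎ₑ-identityʳ _)) (⊎ₑ-cong (≈ₑ-sym (removeEnv-[∶]> k x Q k≤x)) ≈ₑ-refl)))
    (trans s (sym sρ))

mutual
  ⊢-subst-inv : ∀ {k τ w} → Substitutes k τ w → Value w → ∀ t {Γ Q} →
    (π : Γ ⊢ subst τ t ∶ Q) → SubstSplit k w t Γ Q (size π)
  ⊢-subst-inv {k} sub vw (var x) π = ⊢-subst-var-inv k x (<-cmp x k) sub vw π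
  ⊢-subst-inv {k} sub vw (lam t) (lam ps e) with Prems-subst-inv sub vw t ps
  ... | split ps₀ ρ p e' s = split (lam ps₀ ≈ₑ-refl) ρ p (≈ₑ-trans e e') s
  ⊢-subst-inv {k} sub vw (app t u) (app π₁ π₂ q e) with ⊢-subst-inv sub vw t π₁ | ⊢-subst-inv sub vw u π₂
  ... | split {Γ₁} {Δ₁} π₀₁ ρ₁ p₁ e₁ s₁ | split {Γ₂} {Δ₂} π₀₂ ρ₂ p₂ e₂ s₂ with value-merge vw ρ₁ ρ₂
  ...   | ρ , sρ = split (app π₀₁ π₀₂ q ≈ₑ-refl) ρ (⊎-cong p₁ p₂) env (cong suc size≡)
    where
    env : _ ≈ₑ (removeEnv k (Γ₁ ⊎ₑ Γ₂) ⊎ₑ (Δ₁ ⊎ₑ Δ₂))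
    env = ≈ₑ-trans e (≈ₑ-trans (⊎ₑ-cong e₁ e₂) (≈ₑ-trans (⊎ₑ-interchange (removeEnv k Γ₁) Δ₁ (removeEnv k Γ₂) Δ₂)
            (⊎ₑ-cong (≈ₑ-sym (removeEnv-⊎ₑ k Γ₁ Γ₂)) ≈ₑ-refl)))
    size≡ : size π₁ + size π₂ ≡ (size π₀₁ + size π₀₂) + size ρ
    size≡ = +-regroup (size π₀₁) (size π₀₂) s₁ s₂ sρ

  Prems-subst-inv : ∀ {k τ w} → Substitutes k τ w → Value w → ∀ t {Δps L} →
    (ps : Prems (subst (exts τ) t) Δps L) → PremsSubstSplit k w t Δps L (sizeP ps)
  Prems-subst-inv {k} sub vw t [] with value-⊢𝟎 vw
  ... | ρ , sρ = split [] ρ ≈-refl (≈ₑ-sym (≈ₑ-trans (⊎ₑ-cong (removeEnv-∅ k) ≈ₑ-refl) (⊎ₑ-identityʳ ∅))) (sym sρ)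
  Prems-subst-inv {k} sub vw t (_∷_ {Γ' = Γ} π ps)
    with ⊢-subst-inv (exts-Substitutes sub) (value-rename suc vw) t π
  ... | split {Γ₀} π₀ ρπ pπ eπ sπ with ⊢-strengthen 0 _ ρπ | Prems-subst-inv sub vw t ps
  ...   | Δπ , gΔ , ρπ₀ , sρπ | split {Δ₀} {Δw} ps₀ ρr pr er sr with value-merge vw ρπ₀ ρr
  ...     | ρ , sρ with ⊢-transport-env π₀ (≈ₑ-∷ₑ-tail {P = Γ zero} head≈)
    where
    head≈ : Γ₀ zero ≈ Γ zero
    head≈ = ≈-sym (≈-trans (eπ zero) (≈-trans (⊎-cong ≈-refl (gΔ zero)) (⊎-identityʳ _)))
  ...       | π₁ , s₁ = split (π₁ ∷ ps₀) ρ (⊎-cong pπ pr) env size≡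
    where
    env : _ ≈ₑ (removeEnv k (tail Γ₀ ⊎ₑ Δ₀) ⊎ₑ (Δπ ⊎ₑ Δw))
    env = ≈ₑ-trans (⊎ₑ-cong (≈ₑ-trans (tail-cong eπ) (⊎ₑ-cong ≈ₑ-refl (tail-cong gΔ))) er)
            (≈ₑ-trans (⊎ₑ-interchange (removeEnv k (tail Γ₀)) Δπ (removeEnv k Δ₀) Δw)
              (⊎ₑ-cong (≈ₑ-sym (removeEnv-⊎ₑ k (tail Γ₀) Δ₀)) ≈ₑ-refl))
    size≡ : size π + sizeP ps ≡ (size π₁ + sizeP ps₀) + size ρ
    size≡ = +-regroup (size π₁) (sizeP ps₀) (trans sπ (cong₂ _+_ (sym s₁) (sym sρπ))) sr sρ

-- Subject reduction and expansion with exact sizes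

cost : Rule → ℕ
cost βv = 1
cost σ₁ = 0
cost σ₃ = 0

single : Term → ℕ → Term
single w zero    = w
single w (suc n) = var n

single-Substitutes : ∀ w → Substitutes 0 (single w) w
single-Substitutes w = (λ y ()) , refl , (λ y _ → refl)

exts-cong : ∀ {τ τ'} → (∀ x → τ x ≡ τ' x) → ∀ x → exts τ x ≡ exts τ' x
exts-cong h zero    = refl
exts-cong h (suc x) = cong ↑ (h x)

subst-cong : ∀ {τ τ'} → (∀ x → τ x ≡ τ' x) → ∀ t → subst τ t ≡ subst τ' t
subst-cong h (var x)   = h x
subst-cong h (lam t)   = cong lam (subst-cong (exts-cong h) t)
subst-cong h (app t u) = cong₂ app (subst-cong h t) (subst-cong h u)

[]-≡-subst-single : ∀ t w → t [ w ] ≡ subst (single w) t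
[]-≡-subst-single t w = subst-cong (λ { zero → refl ; (suc n) → refl }) t

βv-reduce : ∀ {t w Γ Q} → Value w → (π : Γ ⊢ app (lam t) w ∶ Q) →
  Σ (Γ ⊢ t [ w ] ∶ Q) λ π' → size π ≡ 1 + size π'
βv-reduce {t} {w} {Γ} vw (app {Γ₂ = Δ} (lam (_∷_ {Γ' = G} π₁ []) e₁) ρ p e₂)
  with ⊢-subst (single-Substitutes w) vw π₁ ρ (≈-sym p)
... | π' , s with ⊢-≡ (sym ([]-≡-subst-single t w)) (⊢-transport-env π' env)
  where
  env : (tail G ⊎ₑ Δ) ≈ₑ Γ
  env = ≈ₑ-sym (≈ₑ-trans e₂ (⊎ₑ-cong (≈ₑ-trans e₁ (⊎ₑ-identityʳ _)) ≈ₑ-refl))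
...   | π'' , s'' = π'' , cong suc (trans (cong (_+ size ρ) (+-identityʳ (size π₁))) (sym (trans s'' s)))

βv-expand : ∀ {t w Γ Q} → Value w → (π' : Γ ⊢ t [ w ] ∶ Q) → Γ ⊢ app (lam t) w ∶ Q ⟨ 1 + size π' ⟩
βv-expand {t} {w} vw π' with ⊢-≡ ([]-≡-subst-single t w) (π' , refl)
... | π'' , s'' with ⊢-subst-inv (single-Substitutes w) vw t π''
...   | split π₀ ρ p e s =
  app (lam (π₀ ∷ []) (≈ₑ-sym (⊎ₑ-identityʳ _))) ρ (≈-sym p) e ,
  cong suc (trans (cong (_+ size ρ) (+-identityʳ (size π₀))) (trans (sym s) s''))

σ₁-reduce : ∀ {t u s Γ Q} → (π : Γ ⊢ app (app (lam t) u) s ∶ Q) →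
  Γ ⊢ app (lam (app t (↑ s))) u ∶ Q ⟨ size π ⟩
σ₁-reduce {t} {s = s} {Q = Q} (app {Γ₂ = Γs} (app {Γ₂ = Γu} (lam (_∷_ {Γ' = G} π₁ []) e₁) ρu p₁ e₂) ρs p₂ e₃)
  with ⊢-weaken 0 ρs
... | ρs' , ss = app (lam (body ∷ []) (≈ₑ-sym (⊎ₑ-identityʳ _))) ρu p₁ env , size≡
  where
  body : (G zero ∷ₑ (tail G ⊎ₑ Γs)) ⊢ app t (↑ s) ∶ Q
  body = app π₁ ρs' p₂ λ { zero → ≈-sym (⊎-identityʳ _) ; (suc y) → ≈-refl }
  env : _ ≈ₑ ((tail G ⊎ₑ Γs) ⊎ₑ Γu)
  env = ≈ₑ-trans e₃ (≈ₑ-trans (⊎ₑ-cong (≈ₑ-trans e₂ (⊎ₑ-cong (≈ₑ-trans e₁ (⊎ₑ-identityʳ _)) ≈ₑ-refl)) ≈ₑ-refl)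
                              (⊎ₑ-rightComm (tail G) Γu Γs))
  arith : ∀ m n o → suc ((suc (m + o) + 0) + n) ≡ suc (suc ((m + 0) + n) + o)
  arith = solve-∀
  size≡ : suc ((suc (size π₁ + size ρs') + 0) + size ρu) ≡ suc (suc ((size π₁ + 0) + size ρu) + size ρs)
  size≡ = trans (cong (λ o → suc ((suc (size π₁ + o) + 0) + size ρu)) ss) (arith (size π₁) (size ρu) (size ρs))

σ₁-expand : ∀ {t u s Γ Q} → (π' : Γ ⊢ app (lam (app t (↑ s))) u ∶ Q) →
  Γ ⊢ app (app (lam t) u) s ∶ Q ⟨ size π' ⟩
σ₁-expand {s = s} (app {Γ₂ = Γu} (lam (app {Γ₁ = G₁} {Γ₂ = G₂} π₁ ρs' p₂ eIn ∷ []) e₁) ρu p₁ e₂)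
  with ⊢-strengthen 0 s ρs'
... | Γs , g , ρs , ss =
  app (app (lam (π₁ ∷ []) (≈ₑ-sym (⊎ₑ-identityʳ _))) ρu arg≈ ≈ₑ-refl) ρs p₂ env , size≡
  where
  arg≈ : G₁ zero ≈ _
  arg≈ = ≈-trans (≈-sym (⊎-identityʳ _)) (≈-trans (⊎-cong ≈-refl (≈-sym (g zero))) (≈-trans (≈-sym (eIn zero)) p₁))
  env : _ ≈ₑ ((tail G₁ ⊎ₑ Γu) ⊎ₑ Γs)
  env = ≈ₑ-trans e₂ (≈ₑ-trans (⊎ₑ-cong (≈ₑ-trans e₁ (≈ₑ-trans (⊎ₑ-identityʳ _) (≈ₑ-trans (tail-cong eIn)
          (⊎ₑ-cong ≈ₑ-refl (tail-cong g))))) ≈ₑ-refl) (⊎ₑ-rightComm (tail G₁) Γs Γu))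
  arith : ∀ m n o → suc (suc ((m + 0) + n) + o) ≡ suc ((suc (m + o) + 0) + n)
  arith = solve-∀
  size≡ : suc (suc ((size π₁ + 0) + size ρu) + size ρs) ≡ suc ((suc (size π₁ + size ρs') + 0) + size ρu)
  size≡ = trans (arith (size π₁) (size ρu) (size ρs)) (cong (λ o → suc ((suc (size π₁ + o) + 0) + size ρu)) ss)

σ₃-reduce : ∀ {w s u Γ Q} → (π : Γ ⊢ app w (app (lam s) u) ∶ Q) →
  Γ ⊢ app (lam (app (↑ w) s)) u ∶ Q ⟨ size π ⟩
σ₃-reduce {w} {s} {Q = Q} (app {Γ₁ = Γv} ρv (app {Γ₂ = Γu} (lam (_∷_ {Γ' = G} π₁ []) e₁) ρu p₁ e₂) p₂ e₃)
  with ⊢-weaken 0 ρv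
... | ρv' , sv = app (lam (body ∷ []) (≈ₑ-sym (⊎ₑ-identityʳ _))) ρu p₁ env , size≡
  where
  body : (G zero ∷ₑ (Γv ⊎ₑ tail G)) ⊢ app (↑ w) s ∶ Q
  body = app ρv' π₁ p₂ λ { zero → ≈-sym (⊎-identityˡ _) ; (suc y) → ≈-refl }
  env : _ ≈ₑ ((Γv ⊎ₑ tail G) ⊎ₑ Γu)
  env = ≈ₑ-trans e₃ (≈ₑ-trans (⊎ₑ-cong ≈ₑ-refl (≈ₑ-trans e₂ (⊎ₑ-cong (≈ₑ-trans e₁ (⊎ₑ-identityʳ _)) ≈ₑ-refl)))
                              (≈ₑ-sym (⊎ₑ-assoc Γv (tail G) Γu)))
  arith : ∀ m n o → suc ((suc (m + n) + 0) + o) ≡ suc (m + suc ((n + 0) + o))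
  arith = solve-∀
  size≡ : suc ((suc (size ρv' + size π₁) + 0) + size ρu) ≡ suc (size ρv + suc ((size π₁ + 0) + size ρu))
  size≡ = trans (cong (λ m → suc ((suc (m + size π₁) + 0) + size ρu)) sv) (arith (size ρv) (size π₁) (size ρu))

σ₃-expand : ∀ {w s u Γ Q} → (π' : Γ ⊢ app (lam (app (↑ w) s)) u ∶ Q) →
  Γ ⊢ app w (app (lam s) u) ∶ Q ⟨ size π' ⟩
σ₃-expand {w} (app {Γ₂ = Γu} (lam (app {Γ₁ = G₁} {Γ₂ = G₂} ρv' π₁ p₂ eIn ∷ []) e₁) ρu p₁ e₂)
  with ⊢-strengthen 0 w ρv'
... | Γv , g , ρv , sv =
  app ρv (app (lam (π₁ ∷ []) (≈ₑ-sym (⊎ₑ-identityʳ _))) ρu arg≈ ≈ₑ-refl) p₂ env , size≡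
  where
  arg≈ : G₂ zero ≈ _
  arg≈ = ≈-trans (≈-sym (⊎-identityˡ _)) (≈-trans (⊎-cong (≈-sym (g zero)) ≈-refl) (≈-trans (≈-sym (eIn zero)) p₁))
  env : _ ≈ₑ (Γv ⊎ₑ (tail G₂ ⊎ₑ Γu))
  env = ≈ₑ-trans e₂ (≈ₑ-trans (⊎ₑ-cong (≈ₑ-trans e₁ (≈ₑ-trans (⊎ₑ-identityʳ _) (≈ₑ-trans (tail-cong eIn)
          (⊎ₑ-cong (tail-cong g) ≈ₑ-refl)))) ≈ₑ-refl) (⊎ₑ-assoc Γv (tail G₂) Γu))
  arith : ∀ m n o → suc (m + suc ((n + 0) + o)) ≡ suc ((suc (m + n) + 0) + o)
  arith = solve-∀
  size≡ : suc (size ρv + suc ((size π₁ + 0) + size ρu)) ≡ suc ((suc (size ρv' + size π₁) + 0) + size ρu)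
  size≡ = trans (arith (size ρv) (size π₁) (size ρu)) (cong (λ m → suc ((suc (m + size π₁) + 0) + size ρu)) sv)

cost-under-lam : ∀ c m n → suc (((c + m) + 0) + n) ≡ c + suc ((m + 0) + n)
cost-under-lam = solve-∀

cost-under-appL : ∀ c m n → suc ((c + m) + n) ≡ c + suc (m + n)
cost-under-appL = solve-∀

cost-under-appR : ∀ c m n → suc (m + (c + n)) ≡ c + suc (m + n)
cost-under-appR = solve-∀

⊢-reduce : ∀ {r t t' Γ Q} → Step r t t' → (π : Γ ⊢ t ∶ Q) →
  Σ (Γ ⊢ t' ∶ Q) λ π' → size π ≡ cost r + size π'
⊢-reduce (root (βv-root vw)) π = βv-reduce vw π
⊢-reduce (root σ₁-root) π with σ₁-reduce π
... | π' , s = π' , sym s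
⊢-reduce (root (σ₃-root _)) π with σ₃-reduce π
... | π' , s = π' , sym s
⊢-reduce {r} (lamB st) (app (lam (π₁ ∷ []) e₁) ρ p e₂) with ⊢-reduce st π₁
... | π₁' , s = app (lam (π₁' ∷ []) e₁) ρ p e₂ ,
                trans (cong (λ n → suc ((n + 0) + size ρ)) s) (cost-under-lam (cost r) (size π₁') (size ρ))
⊢-reduce {r} (appL st) (app π₁ ρ p e) with ⊢-reduce st π₁
... | π₁' , s = app π₁' ρ p e , trans (cong (λ n → suc (n + size ρ)) s) (cost-under-appL (cost r) (size π₁') (size ρ))
⊢-reduce {r} (appR st) (app π₁ ρ p e) with ⊢-reduce st ρ
... | ρ' , s = app π₁ ρ' p e , trans (cong (λ n → suc (size π₁ + n)) s) (cost-under-appR (cost r) (size π₁) (size ρ'))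

⊢-expand : ∀ {r t t' Γ Q} → Step r t t' → (π' : Γ ⊢ t' ∶ Q) → Γ ⊢ t ∶ Q ⟨ cost r + size π' ⟩
⊢-expand (root (βv-root vw)) π' = βv-expand vw π'
⊢-expand (root σ₁-root)      π' = σ₁-expand π'
⊢-expand (root (σ₃-root _))  π' = σ₃-expand π'
⊢-expand {r} (lamB st) (app (lam (π₁ ∷ []) e₁) ρ p e₂) with ⊢-expand st π₁
... | π₁' , s = app (lam (π₁' ∷ []) e₁) ρ p e₂ ,
                trans (cong (λ n → suc ((n + 0) + size ρ)) s) (cost-under-lam (cost r) (size π₁) (size ρ))
⊢-expand {r} (appL st) (app π₁ ρ p e) with ⊢-expand st π₁
... | π₁' , s = app π₁' ρ p e , trans (cong (λ n → suc (n + size ρ)) s) (cost-under-appL (cost r) (size π₁) (size ρ))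
⊢-expand {r} (appR st) (app π₁ ρ p e) with ⊢-expand st ρ
... | ρ' , s = app π₁ ρ' p e , trans (cong (λ n → suc (size π₁ + n)) s) (cost-under-appR (cost r) (size π₁) (size ρ))

#βv-∷ : ∀ {r t t' t''} (st : Step r t t') (d : Seq t' t'') n → cost r + (#βv d + n) ≡ #βv (st ∷ d) + n
#βv-∷ {βv} _ _ _ = refl
#βv-∷ {σ₁} _ _ _ = refl
#βv-∷ {σ₃} _ _ _ = refl

⊢-reduce* : ∀ {t t₀ Γ Q} → (d : Seq t t₀) → (π : Γ ⊢ t ∶ Q) →
  Σ (Γ ⊢ t₀ ∶ Q) λ π₀ → size π ≡ #βv d + size π₀
⊢-reduce* done π = π , refl
⊢-reduce* (_∷_ {r = r} st d) π with ⊢-reduce st π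
... | π' , s with ⊢-reduce* d π'
...   | π₀ , s' = π₀ , trans s (trans (cong (cost r +_) s') (#βv-∷ st d (size π₀)))

⊢-expand* : ∀ {t t₀ Γ Q} → (d : Seq t t₀) → (π₀ : Γ ⊢ t₀ ∶ Q) → Γ ⊢ t ∶ Q ⟨ #βv d + size π₀ ⟩
⊢-expand* done π₀ = π₀ , refl
⊢-expand* (_∷_ {r = r} st d) π₀ with ⊢-expand* d π₀
... | π' , s' with ⊢-expand st π'
...   | π , s = π , trans s (trans (cong (cost r +_) s') (#βv-∷ st d (size π₀)))

-- Derivations of normal forms

mutual
  ∣∣₀ᵃ≤size : ∀ {t} (g : GenA t) {Γ Q} (π : Γ ⊢ t ∶ Q) → ∣ g ∣₀ᵃ ≤ size π
  ∣∣₀ᵃ≤size (xv x _) (app _ _ _ _)  = s≤s z≤n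
  ∣∣₀ᵃ≤size (xa x g) (app π ρ _ _)  = s≤s (≤-trans (∣∣₀ᵃ≤size g ρ) (m≤n+m _ _))
  ∣∣₀ᵃ≤size (an g h) (app π ρ _ _)  = s≤s (+-mono-≤ (∣∣₀ᵃ≤size g π) (∣∣₀≤size h ρ))

  ∣∣₀≤size : ∀ {t} (g : GenN t) {Γ Q} (π : Γ ⊢ t ∶ Q) → ∣ g ∣₀ ≤ size π
  ∣∣₀≤size (v _)     π = z≤n
  ∣∣₀≤size (a g)     π = ∣∣₀ᵃ≤size g π
  ∣∣₀≤size (λna g h) (app (lam (π ∷ []) _) ρ _ _) =
    s≤s (+-mono-≤ (≤-trans (∣∣₀≤size g π) (m≤m+n _ 0)) (∣∣₀ᵃ≤size h ρ))

mutual
  ⊢-of-size-∣∣₀ᵃ : ∀ {t} (g : GenA t) Q → Σ Env λ Γ → Γ ⊢ t ∶ Q ⟨ ∣ g ∣₀ᵃ ⟩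
  ⊢-of-size-∣∣₀ᵃ (xv x vw) Q with value-⊢𝟎 vw
  ... | ρ , s = _ , app (ax {x = x} {P = mset ((𝟎 , Q) ∷ [])} ≈ₑ-refl) ρ ≈-refl ≈ₑ-refl , cong suc s
  ⊢-of-size-∣∣₀ᵃ (xa x g) Q with ⊢-of-size-∣∣₀ᵃ g 𝟎
  ... | _ , ρ , s = _ , app (ax {x = x} {P = mset ((𝟎 , Q) ∷ [])} ≈ₑ-refl) ρ ≈-refl ≈ₑ-refl , cong suc s
  ⊢-of-size-∣∣₀ᵃ (an g h) Q with ⊢-of-size-∣∣₀ᵃ g (mset ((𝟎 , Q) ∷ [])) | ⊢-of-size-∣∣₀ h
  ... | _ , π , s | _ , ρ , s' = _ , app π ρ ≈-refl ≈ₑ-refl , cong suc (cong₂ _+_ s s')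

  ⊢-of-size-∣∣₀ : ∀ {t} (g : GenN t) → Σ Env λ Γ → Γ ⊢ t ∶ 𝟎 ⟨ ∣ g ∣₀ ⟩
  ⊢-of-size-∣∣₀ (v vw) = _ , value-⊢𝟎 vw
  ⊢-of-size-∣∣₀ (a g)  = ⊢-of-size-∣∣₀ᵃ g 𝟎
  ⊢-of-size-∣∣₀ (λna g h) with ⊢-of-size-∣∣₀ g
  ... | Γ , π , s with ⊢-of-size-∣∣₀ᵃ h (Γ zero)
  ...   | _ , ρ , s' = _ , app (lam (π ∷ []) ≈ₑ-refl) ρ ≈-refl ≈ₑ-refl ,
                       cong suc (cong₂ _+_ (trans (+-identityʳ _) s) s')

value-∣∣₀≡0 : ∀ {t} → Value t → (g : GenN t) → ∣ g ∣₀ ≡ 0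
value-∣∣₀≡0 _       (v _)  = refl
value-∣∣₀≡0 (var x) (a ())
value-∣∣₀≡0 (lam t) (a ())

size-lower-bound : ∀ {t t₀ Γ Q} (d : Seq t t₀) (g : GenN t₀) (π : Γ ⊢ t ∶ Q) → #βv d + ∣ g ∣₀ ≤ size π
size-lower-bound d g π with ⊢-reduce* d π
... | π₀ , s = ≤-trans (+-monoʳ-≤ (#βv d) (∣∣₀≤size g π₀)) (≤-reflexive (sym s))

⊢-of-size-#βv+∣∣₀ : ∀ {t t₀} (d : Seq t t₀) (g : GenN t₀) →
  Σ Env λ Γ → Γ ⊢ t ∶ 𝟎 ⟨ #βv d + ∣ g ∣₀ ⟩
⊢-of-size-#βv+∣∣₀ d g with ⊢-of-size-∣∣₀ g
... | Γ , π₀ , s₀ with ⊢-expand* d π₀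
...   | π , s = Γ , π , trans s (cong (#βv d +_) s₀)

minimal-size : ∀ {t t₀} (d : Seq t t₀) (g : GenN t₀) (π : Deriv t) → Minimal π → #βv d + ∣ g ∣₀ ≡ ∣ π ∣
minimal-size d g (_ , _ , π) π-min with ⊢-of-size-#βv+∣∣₀ d g
... | Γ , π' , s = ≤-antisym (size-lower-bound d g π) (≤-trans (π-min (Γ , 𝟎 , π')) (≤-reflexive s))

mainTheorem2 : ∀ (t t₀ : Term) → ShufNormal t₀ → (g : GenN t₀) →
    (d : Seq t t₀) → (π : Deriv t) → Minimal π → (π₀ : Deriv t₀) → Minimal π₀ →
    ((#βv d + ∣ g ∣₀ ≡ ∣ π ∣) × (#βv d + ∣ π₀ ∣ ≡ ∣ π ∣))
    × (Value t₀ → #βv d ≡ ∣ π ∣)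
mainTheorem2 t t₀ _ g d π π-min π₀ π₀-min = (β+∣g∣≡∣π∣ , β+∣π₀∣≡∣π∣) , value-case
  where
  β+∣g∣≡∣π∣ : #βv d + ∣ g ∣₀ ≡ ∣ π ∣
  β+∣g∣≡∣π∣ = minimal-size d g π π-min

  β+∣π₀∣≡∣π∣ : #βv d + ∣ π₀ ∣ ≡ ∣ π ∣
  β+∣π₀∣≡∣π∣ = trans (cong (#βv d +_) (sym (minimal-size done g π₀ π₀-min))) β+∣g∣≡∣π∣

  value-case : Value t₀ → #βv d ≡ ∣ π ∣
  value-case vt = begin
    #βv d             ≡⟨ sym (+-identityʳ (#βv d)) ⟩
    #βv d + 0         ≡⟨ cong (#βv d +_) (sym (value-∣∣₀≡0 vt g)) ⟩
    #βv d + ∣ g ∣₀    ≡⟨ β+∣g∣≡∣π∣ ⟩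
    ∣ π ∣             ∎
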